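{- Let $1<n\le m$ and let $v$ be a vertex of $Z_{n,m}$ with $I_c(v)\subseteq[1,m]$ and $\sum_{i\in I_c(v)}v_i=0$. Then $d(v,0)\le\sum_{i=1}^{p_l(v)}i+\sum_{i=1}^{m-p_r(v)}i+\lfloor\frac{\gamma}{2}\rfloor\lceil\frac{\gamma}{2}\rceil$, where $\gamma=|I_c(v)|$.
   Context: Elements of $\mathbb{Z}_n$ are identified with their smallest nonnegative representatives in $\{0,\dots,n-1\}$. The dYoke graph $Z_{n,m}$ has as vertices all tuples $u=(u_0,\dots,u_{m+1})$ with $u_0,u_{m+1}\in\mathbb{Z}_n$, $u_1,\dots,u_m\in\{ -1,0,1\}$ and $\sum_{i=0}^{m+1}u_i\equiv0\pmod n$; adjacency: there is $0\le i\le m$ with $u_j=v_j$ for $j\notin\{i,i+1\}$ and either ($u_i=v_i+1$, $u_{i+1}=v_{i+1}-1$) or ($u_i=v_i-1$, $u_{i+1}=v_{i+1}+1$), arithmetic in coordinates $0,m+1$ in $\mathbb{Z}_n$. $0$ is the all-zero vertex, $d$ is graph distance. A pivot of $v$ is an integer $-1\le p\le m+1$ such that $n\mid\sum_{i=0}^{p}v_i$ (empty sum $=0$); $\operatorname{Piv}(v)$ is the set of pivots. $p_l(v)=\max\{p\in\operatorname{Piv}(v):p<\frac m2\}$, $p_r(v)=\min\{p\in\operatorname{Piv}(v):p\ge\frac m2\}$, $I_c(v)=[p_l(v)+1,p_r(v)]$ (integer interval). -}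

module Defs where

open import Data.Nat as ℕ using (ℕ; zero; suc; ⌊_/2⌋; ⌈_/2⌉)
open import Data.Nat.Properties using (_<?_)
open import Data.Integer as ℤ using (ℤ; +_; -[1+_]; 0ℤ; 1ℤ; -1ℤ; ∣_∣)
open import Data.Integer.Divisibility using (_∣_)
open import Data.Fin using (Fin; zero; suc; toℕ; inject₁; fromℕ; fromℕ<)
open import Data.Product using (Σ; ∃; ∃-syntax; _×_; _,_)
open import Data.Sum using (_⊎_)
open import Relation.Nullary using (¬_; yes; no)
open import Relation.Binary.PropositionalEquality using (_≡_; _≢_)

-- value of an (m+2)-tuple at a natural index (0 outside the range)
at : {N : ℕ} → (Fin N → ℤ) → ℕ → ℤ
at {N} u i with i <? N
... | yes p = u (fromℕ< p)
... | no _  = 0ℤ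

prefixSum : (ℕ → ℤ) → ℕ → ℤ
prefixSum f zero    = 0ℤ
prefixSum f (suc k) = prefixSum f k ℤ.+ f k

rangeSum : (ℕ → ℤ) → ℕ → ℕ → ℤ
rangeSum f a zero      = 0ℤ
rangeSum f a (suc len) = f a ℤ.+ rangeSum f (suc a) len

tri : ℕ → ℕ
tri zero    = 0
tri (suc k) = suc k ℕ.+ tri k

Trit : ℤ → Set
Trit x = x ≡ -1ℤ ⊎ x ≡ 0ℤ ⊎ x ≡ 1ℤ

-- x is the smallest nonnegative representative of an element of ℤ_n
Rep : ℕ → ℤ → Set
Rep n x = ∃[ k ] (k ℕ.< n × x ≡ + k)

-- Vertices of the dYoke graph Z_{n,m}: tuples (u_0,…,u_{m+1}) indexed by Fin (2+m)
record Vertex (n m : ℕ) : Set where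
  field
    coord : Fin (suc (suc m)) → ℤ
    first : Rep n (coord zero)
    last  : Rep n (coord (fromℕ (suc m)))
    mid   : (i : Fin m) → Trit (coord (suc (inject₁ i)))
    sum≡0 : (+ n) ∣ prefixSum (at coord) (suc (suc m))
open Vertex public

-- coordinates 0 and m+1 are the ℤ_n-coordinates
IsEnd : (m : ℕ) → Fin (suc (suc m)) → Set
IsEnd m j = toℕ j ≡ 0 ⊎ toℕ j ≡ suc m

Shift : (n m : ℕ) → Fin (suc (suc m)) → ℤ → ℤ → ℤ → Set
Shift n m j a b δ = (IsEnd m j → (+ n) ∣ (a ℤ.- (b ℤ.+ δ)))
                  × (¬ IsEnd m j → a ≡ b ℤ.+ δ)

Adj : {n m : ℕ} → Vertex n m → Vertex n m → Set
Adj {n} {m} u v = ∃[ i ]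
  ( (∀ j → j ≢ inject₁ i → j ≢ suc i → coord u j ≡ coord v j)
  × ( (Shift n m (inject₁ i) (coord u (inject₁ i)) (coord v (inject₁ i)) 1ℤ
       × Shift n m (suc i) (coord u (suc i)) (coord v (suc i)) -1ℤ)
    ⊎ (Shift n m (inject₁ i) (coord u (inject₁ i)) (coord v (inject₁ i)) -1ℤ
       × Shift n m (suc i) (coord u (suc i)) (coord v (suc i)) 1ℤ)))

IsZero : {n m : ℕ} → Vertex n m → Set
IsZero {n} {m} v = ∀ j → coord v j ≡ 0ℤ

data WalkToZero {n m : ℕ} : ℕ → Vertex n m → Set where
  here : ∀ {v} → IsZero v → WalkToZero zero v
  step : ∀ {k u w} → Adj u w → WalkToZero k w → WalkToZero (suc k) u

DistZero≤ : {n m : ℕ} → Vertex n m → ℕ → Set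
DistZero≤ v B = ∃[ k ] (k ℕ.≤ B × WalkToZero k v)

-- p ∈ Piv(v), p ∈ ℤ with -1 ≤ p ≤ m+1; Σ_{i=0}^{p} v_i = prefix sum of p+1 terms
Pivot : {n m : ℕ} → Vertex n m → ℤ → Set
Pivot {n} {m} v p = (-1ℤ ℤ.≤ p) × (p ℤ.≤ + suc m)
                  × ((+ n) ∣ prefixSum (at (coord v)) (∣ p ℤ.+ 1ℤ ∣))

-- p < m/2  ⇔  2p < m ;  p ≥ m/2  ⇔  m ≤ 2p
IsPl : {n m : ℕ} → Vertex n m → ℤ → Set
IsPl {n} {m} v p = Pivot v p × ((+ 2) ℤ.* p ℤ.< + m)
  × (∀ q → Pivot v q → (+ 2) ℤ.* q ℤ.< + m → q ℤ.≤ p)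

IsPr : {n m : ℕ} → Vertex n m → ℤ → Set
IsPr {n} {m} v p = Pivot v p × (+ m ℤ.≤ (+ 2) ℤ.* p)
  × (∀ q → Pivot v q → + m ℤ.≤ (+ 2) ℤ.* q → p ℤ.≤ q)

-- Write P_k = v_1 + … + v_k and a = p_l, b = p_r; the hypotheses say that a is a
-- pivot and P_b = P_a.  The proof is a descent on the potential
--   Φ(v) = Σ_{k=0}^{m} |P_k - P_a| :
-- if Φ(v) > 0, choose c with |P_c - P_a| maximal; moving one unit between the
-- coordinates c and c+1 so that |P_c - P_a| shrinks is an edge of Z_{n,m}, keeps a
-- a pivot and lowers Φ by one (Transfer, Descent.descent-step); if Φ(v) = 0 then v
-- is the zero vertex (vanishing-partials).  Hence d(v,0) ≤ Φ(v) (Descent.descend).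
-- Since k ↦ P_k - P_a moves by at most one per step and vanishes at a and at b,
-- Φ(v) is bounded by two triangles and a "tent" over [a, b] (two-zeros-bound).
module Submission where

open import Defs
open import Data.Nat as ℕ using (ℕ; zero; suc; ⌊_/2⌋; ⌈_/2⌉; z≤n; s≤s; _⊓_; _∸_; NonZero)
import Data.Nat.Properties as NP
open import Data.Nat.DivMod using (m<n⇒m%n≡m)
import Data.Nat.Divisibility as ND
open import Data.Integer as ℤ using (ℤ; +_; -[1+_]; 0ℤ; 1ℤ; -1ℤ; ∣_∣; _◃_)
import Data.Integer.Properties as IP
open import Data.Integer.DivMod using (_%ℕ_; _/ℕ_; n%ℕd<d; a≡a%ℕn+[a/ℕn]*n)
import Data.Integer.Divisibility as DU
open import Data.Integer.Divisibility.Signed as DS using (_∣_)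
open import Data.Integer.Tactic.RingSolver using (solve-∀)
open import Data.Sign as Sign using (Sign)
open import Data.Fin as F using (Fin; toℕ; fromℕ<; fromℕ; inject₁)
import Data.Fin.Properties as FP
open import Data.Product using (Σ; ∃-syntax; _×_; _,_; proj₁; proj₂)
open import Data.Sum using (_⊎_; inj₁; inj₂)
open import Data.Empty using (⊥-elim)
open import Relation.Nullary using (¬_; yes; no; Dec)
open import Relation.Nullary.Decidable using (toSum)
open import Relation.Binary.PropositionalEquality

sumFrom : (ℕ → ℕ) → ℕ → ℕ → ℕ
sumFrom h s zero    = 0
sumFrom h s (suc l) = h s ℕ.+ sumFrom h (suc s) l

sumFrom-mono : ∀ h g s t l → (∀ j → j ℕ.< l → h (s ℕ.+ j) ℕ.≤ g (t ℕ.+ j))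
             → sumFrom h s l ℕ.≤ sumFrom g t l
sumFrom-mono h g s t zero    le = z≤n
sumFrom-mono h g s t (suc l) le = NP.+-mono-≤ head tail
  where
  head : h s ℕ.≤ g t
  head = subst₂ (λ x y → h x ℕ.≤ g y) (NP.+-identityʳ s) (NP.+-identityʳ t) (le 0 (s≤s z≤n))
  tail : sumFrom h (suc s) l ℕ.≤ sumFrom g (suc t) l
  tail = sumFrom-mono h g (suc s) (suc t) l (λ j j<l →
    subst₂ (λ x y → h x ℕ.≤ g y) (NP.+-suc s j) (NP.+-suc t j) (le (suc j) (s≤s j<l)))

sumFrom-split : ∀ h s p q → sumFrom h s (p ℕ.+ q) ≡ sumFrom h s p ℕ.+ sumFrom h (s ℕ.+ p) q
sumFrom-split h s zero    q = cong (λ x → sumFrom h x q) (sym (NP.+-identityʳ s))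
sumFrom-split h s (suc p) q = begin
  h s ℕ.+ sumFrom h (suc s) (p ℕ.+ q)
    ≡⟨ cong (h s ℕ.+_) (sumFrom-split h (suc s) p q) ⟩
  h s ℕ.+ (sumFrom h (suc s) p ℕ.+ sumFrom h (suc s ℕ.+ p) q)
    ≡⟨ cong (λ x → h s ℕ.+ (sumFrom h (suc s) p ℕ.+ sumFrom h x q)) (sym (NP.+-suc s p)) ⟩
  h s ℕ.+ (sumFrom h (suc s) p ℕ.+ sumFrom h (s ℕ.+ suc p) q)
    ≡⟨ sym (NP.+-assoc (h s) _ _) ⟩
  sumFrom h s (suc p) ℕ.+ sumFrom h (s ℕ.+ suc p) q ∎
  where open ≡-Reasoning

sumFrom-cong : ∀ h g s l → (∀ k → s ℕ.≤ k → k ℕ.< s ℕ.+ l → h k ≡ g k)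
             → sumFrom h s l ≡ sumFrom g s l
sumFrom-cong h g s zero    eq = refl
sumFrom-cong h g s (suc l) eq =
  cong₂ ℕ._+_ (eq s NP.≤-refl (NP.m<m+n s (s≤s z≤n)))
    (sumFrom-cong h g (suc s) l (λ k s<k k<end →
      eq k (NP.<⇒≤ s<k) (subst (k ℕ.<_) (sym (NP.+-suc s l)) k<end)))

sumFrom-drop : ∀ h h' c s l
             → (∀ k → s ℕ.≤ k → k ℕ.< s ℕ.+ l → k ≢ c → h' k ≡ h k) → suc (h' c) ≡ h c
             → s ℕ.≤ c → c ℕ.< s ℕ.+ l → suc (sumFrom h' s l) ℕ.≤ sumFrom h s l
sumFrom-drop h h' c s zero eq drop s≤c c<s =
  ⊥-elim (NP.<⇒≱ (subst (c ℕ.<_) (NP.+-identityʳ s) c<s) s≤c)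
sumFrom-drop h h' c s (suc l) eq drop s≤c c<end with c ℕ.≟ s
... | yes refl =
  subst₂ (λ x y → suc (h' c ℕ.+ x) ℕ.≤ y ℕ.+ sumFrom h (suc c) l)
    (sym (sumFrom-cong h' h (suc c) l (λ k c<k k<end →
      eq k (NP.<⇒≤ c<k) (subst (k ℕ.<_) (sym (NP.+-suc c l)) k<end) (NP.>⇒≢ c<k))))
    drop NP.≤-refl
... | no c≢s =
  subst (λ x → suc (h' s ℕ.+ sumFrom h' (suc s) l) ℕ.≤ x ℕ.+ sumFrom h (suc s) l)
    (eq s NP.≤-refl (NP.m<m+n s (s≤s z≤n)) (λ s≡c → c≢s (sym s≡c)))
    (subst (ℕ._≤ h' s ℕ.+ sumFrom h (suc s) l) (NP.+-suc (h' s) _)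
      (NP.+-monoʳ-≤ (h' s) rest))
  where
  rest : suc (sumFrom h' (suc s) l) ℕ.≤ sumFrom h (suc s) l
  rest = sumFrom-drop h h' c (suc s) l
           (λ k s<k k<end → eq k (NP.<⇒≤ s<k) (subst (k ℕ.<_) (sym (NP.+-suc s l)) k<end))
           drop (NP.≤∧≢⇒< s≤c (λ s≡c → c≢s (sym s≡c)))
           (subst (c ℕ.<_) (NP.+-suc s l) c<end)

sumFrom-suc : ∀ h s l → sumFrom (λ k → suc (h k)) s l ≡ l ℕ.+ sumFrom h s l
sumFrom-suc h s zero    = refl
sumFrom-suc h s (suc l) = cong suc (begin
  h s ℕ.+ sumFrom (λ k → suc (h k)) (suc s) l ≡⟨ cong (h s ℕ.+_) (sumFrom-suc h (suc s) l) ⟩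
  h s ℕ.+ (l ℕ.+ sumFrom h (suc s) l)         ≡⟨ sym (NP.+-assoc (h s) l _) ⟩
  (h s ℕ.+ l) ℕ.+ sumFrom h (suc s) l         ≡⟨ cong (ℕ._+ sumFrom h (suc s) l) (NP.+-comm (h s) l) ⟩
  (l ℕ.+ h s) ℕ.+ sumFrom h (suc s) l         ≡⟨ NP.+-assoc l (h s) _ ⟩
  l ℕ.+ (h s ℕ.+ sumFrom h (suc s) l)         ∎)
  where open ≡-Reasoning

argmax : ∀ (h : ℕ → ℕ) N → ∃[ c ] (c ℕ.≤ N × (∀ k → k ℕ.≤ N → h k ℕ.≤ h c))
argmax h zero = 0 , z≤n , λ { k z≤n → NP.≤-refl }
argmax h (suc N) with argmax h N
... | c , c≤N , max with h c ℕ.≤? h (suc N)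
...   | yes hc≤hN = suc N , NP.≤-refl , bound
  where
  bound : ∀ k → k ℕ.≤ suc N → h k ℕ.≤ h (suc N)
  bound k k≤ with NP.m≤n⇒m<n∨m≡n k≤
  ... | inj₁ (s≤s k≤N) = NP.≤-trans (max k k≤N) hc≤hN
  ... | inj₂ refl      = NP.≤-refl
...   | no hc≰hN = c , NP.m≤n⇒m≤1+n c≤N , bound
  where
  bound : ∀ k → k ℕ.≤ suc N → h k ℕ.≤ h c
  bound k k≤ with NP.m≤n⇒m<n∨m≡n k≤
  ... | inj₁ (s≤s k≤N) = max k k≤N
  ... | inj₂ refl      = NP.<⇒≤ (NP.≰⇒> hc≰hN)

sumFrom-countdown : ∀ s l → sumFrom (λ k → (s ℕ.+ l) ∸ k) s l ≡ tri l
sumFrom-countdown s zero = refl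
sumFrom-countdown s (suc l) rewrite NP.+-suc s l =
  cong₂ ℕ._+_ (trans (cong (_∸ s) (sym (NP.+-suc s l))) (NP.m+n∸m≡n s (suc l)))
              (sumFrom-countdown (suc s) l)

sumFrom-countup : ∀ s l → sumFrom (λ k → k ∸ s) s (suc l) ≡ tri l
sumFrom-countup s zero    = cong (ℕ._+ 0) (NP.n∸n≡0 s)
sumFrom-countup s (suc l) = begin
  sumFrom h s (suc (suc l))                    ≡⟨ cong (sumFrom h s) (NP.+-comm 1 (suc l)) ⟩
  sumFrom h s (suc l ℕ.+ 1)                    ≡⟨ sumFrom-split h s (suc l) 1 ⟩
  sumFrom h s (suc l) ℕ.+ (h (s ℕ.+ suc l) ℕ.+ 0)
    ≡⟨ cong₂ ℕ._+_ (sumFrom-countup s l) (trans (NP.+-identityʳ _) (NP.m+n∸m≡n s (suc l))) ⟩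
  tri l ℕ.+ suc l                              ≡⟨ NP.+-comm (tri l) (suc l) ⟩
  tri (suc l)                                  ∎
  where
  open ≡-Reasoning
  h : ℕ → ℕ
  h k = k ∸ s

-- The "tent" Σ_{j<γ} min(j, γ-j): it bounds Σ |g| over a segment of length γ
-- of length γ on which a 1-Lipschitz function vanishes at both ends.
tent : ℕ → ℕ
tent γ = sumFrom (λ j → j ⊓ (γ ∸ j)) 0 γ

tent-step : ∀ γ → tent (suc (suc γ)) ℕ.≤ suc γ ℕ.+ tent γ
tent-step γ = begin
  sumFrom wide 1 (suc γ)                  ≤⟨ sumFrom-mono wide (λ j → suc (narrow j)) 1 0 (suc γ) pointwise ⟩
  sumFrom (λ j → suc (narrow j)) 0 (suc γ) ≡⟨ sumFrom-suc narrow 0 (suc γ) ⟩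
  suc γ ℕ.+ sumFrom narrow 0 (suc γ)       ≡⟨ cong (λ x → suc γ ℕ.+ sumFrom narrow 0 x) (NP.+-comm 1 γ) ⟩
  suc γ ℕ.+ sumFrom narrow 0 (γ ℕ.+ 1)     ≡⟨ cong (suc γ ℕ.+_) (sumFrom-split narrow 0 γ 1) ⟩
  suc γ ℕ.+ (tent γ ℕ.+ (narrow γ ℕ.+ 0))  ≡⟨ cong (λ x → suc γ ℕ.+ (tent γ ℕ.+ x)) lastTerm ⟩
  suc γ ℕ.+ (tent γ ℕ.+ 0)                 ≡⟨ cong (suc γ ℕ.+_) (NP.+-identityʳ _) ⟩
  suc γ ℕ.+ tent γ                         ∎
  where
  open NP.≤-Reasoning
  narrow wide : ℕ → ℕ
  narrow j = j ⊓ (γ ∸ j)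
  wide j = j ⊓ (suc (suc γ) ∸ j)
  pointwise : ∀ j → j ℕ.< suc γ → wide (1 ℕ.+ j) ℕ.≤ suc (narrow (0 ℕ.+ j))
  pointwise j (s≤s j≤γ) = NP.≤-reflexive (cong (suc j ⊓_) (NP.+-∸-assoc 1 j≤γ))
  lastTerm : narrow γ ℕ.+ 0 ≡ 0
  lastTerm = trans (NP.+-identityʳ _) (trans (cong (γ ⊓_) (NP.n∸n≡0 γ)) (NP.m≥n⇒m⊓n≡n (z≤n {γ})))

tent-bound : ∀ γ → tent γ ℕ.≤ ⌊ γ /2⌋ ℕ.* ⌈ γ /2⌉
tent-bound zero          = z≤n
tent-bound (suc zero)    = z≤n
tent-bound (suc (suc γ)) = begin
  tent (suc (suc γ))        ≤⟨ tent-step γ ⟩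
  suc γ ℕ.+ tent γ          ≤⟨ NP.+-monoʳ-≤ (suc γ) (tent-bound γ) ⟩
  suc γ ℕ.+ x ℕ.* y         ≡⟨ cong (λ z → suc z ℕ.+ x ℕ.* y) (sym (NP.⌊n/2⌋+⌈n/2⌉≡n γ)) ⟩
  suc (x ℕ.+ y) ℕ.+ x ℕ.* y ≡⟨ cong suc (expand x y) ⟩
  suc x ℕ.* suc y           ∎
  where
  open NP.≤-Reasoning
  x y : ℕ
  x = ⌊ γ /2⌋
  y = ⌈ γ /2⌉
  expand : ∀ x y → (x ℕ.+ y) ℕ.+ x ℕ.* y ≡ y ℕ.+ x ℕ.* suc y
  expand x y rewrite NP.*-suc x y =
    trans (cong (ℕ._+ x ℕ.* y) (NP.+-comm x y)) (NP.+-assoc y x _)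

Lipschitz : (ℕ → ℤ) → ℕ → Set
Lipschitz g m = ∀ k → k ℕ.< m → ∣ g (suc k) ℤ.- g k ∣ ℕ.≤ 1

module _ {g : ℕ → ℤ} {m : ℕ} (lip : Lipschitz g m) where

  lipschitz-steps : ∀ k d → k ℕ.+ d ℕ.≤ m → ∣ g (k ℕ.+ d) ℤ.- g k ∣ ℕ.≤ d
  lipschitz-steps k zero _ rewrite NP.+-identityʳ k = NP.≤-reflexive (cong ∣_∣ (IP.+-inverseʳ (g k)))
  lipschitz-steps k (suc d) le rewrite NP.+-suc k d = begin
    ∣ g (suc (k ℕ.+ d)) ℤ.- g k ∣
      ≡⟨ cong ∣_∣ (telescope (g (suc (k ℕ.+ d))) (g (k ℕ.+ d)) (g k)) ⟩
    ∣ (g (k ℕ.+ d) ℤ.- g k) ℤ.+ (g (suc (k ℕ.+ d)) ℤ.- g (k ℕ.+ d)) ∣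
      ≤⟨ IP.∣i+j∣≤∣i∣+∣j∣ (g (k ℕ.+ d) ℤ.- g k) (g (suc (k ℕ.+ d)) ℤ.- g (k ℕ.+ d)) ⟩
    ∣ g (k ℕ.+ d) ℤ.- g k ∣ ℕ.+ ∣ g (suc (k ℕ.+ d)) ℤ.- g (k ℕ.+ d) ∣
      ≤⟨ NP.+-mono-≤ (lipschitz-steps k d (NP.<⇒≤ le)) (lip (k ℕ.+ d) le) ⟩
    d ℕ.+ 1
      ≡⟨ NP.+-comm d 1 ⟩
    suc d ∎
    where
    open NP.≤-Reasoning
    telescope : ∀ z y x → z ℤ.- x ≡ (y ℤ.- x) ℤ.+ (z ℤ.- y)
    telescope = solve-∀

  lipschitz-dist : ∀ k j → k ℕ.≤ j → j ℕ.≤ m → ∣ g j ℤ.- g k ∣ ℕ.≤ j ∸ k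
  lipschitz-dist k j k≤j j≤m =
    subst (λ i → ∣ g i ℤ.- g k ∣ ℕ.≤ j ∸ k) (NP.m+[n∸m]≡n k≤j)
      (lipschitz-steps k (j ∸ k) (subst (ℕ._≤ m) (sym (NP.m+[n∸m]≡n k≤j)) j≤m))

  below-zero : ∀ z j → g z ≡ 0ℤ → j ℕ.≤ z → z ℕ.≤ m → ∣ g j ∣ ℕ.≤ z ∸ j
  below-zero z j gz j≤z z≤m = subst (ℕ._≤ z ∸ j) distance (lipschitz-dist j z j≤z z≤m)
    where
    distance : ∣ g z ℤ.- g j ∣ ≡ ∣ g j ∣
    distance = trans (cong (λ y → ∣ y ℤ.- g j ∣) gz)
                     (trans (cong ∣_∣ (IP.+-identityˡ (ℤ.- g j))) (IP.∣-i∣≡∣i∣ (g j)))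

  above-zero : ∀ z j → g z ≡ 0ℤ → z ℕ.≤ j → j ℕ.≤ m → ∣ g j ∣ ℕ.≤ j ∸ z
  above-zero z j gz z≤j j≤m = subst (ℕ._≤ j ∸ z) distance (lipschitz-dist z j z≤j j≤m)
    where
    distance : ∣ g j ℤ.- g z ∣ ≡ ∣ g j ∣
    distance = trans (cong (λ y → ∣ g j ℤ.- y ∣) gz) (cong ∣_∣ (IP.+-identityʳ (g j)))

  two-zeros-bound : ∀ a γ r → (a ℕ.+ γ) ℕ.+ r ≡ m → g a ≡ 0ℤ → g (a ℕ.+ γ) ≡ 0ℤ
    → sumFrom (λ k → ∣ g k ∣) 0 (suc m) ℕ.≤ tri a ℕ.+ tri r ℕ.+ ⌊ γ /2⌋ ℕ.* ⌈ γ /2⌉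
  two-zeros-bound a γ r a+γ+r≡m ga gb = begin
    sumFrom h 0 (suc m)                                ≡⟨ cong (sumFrom h 0) m+1≡a+γ+r+1 ⟩
    sumFrom h 0 (a ℕ.+ (γ ℕ.+ suc r))                  ≡⟨ sumFrom-split h 0 a (γ ℕ.+ suc r) ⟩
    sumFrom h 0 a ℕ.+ sumFrom h a (γ ℕ.+ suc r)        ≡⟨ cong (sumFrom h 0 a ℕ.+_) (sumFrom-split h a γ (suc r)) ⟩
    sumFrom h 0 a ℕ.+ (sumFrom h a γ ℕ.+ sumFrom h b (suc r))
      ≤⟨ NP.+-mono-≤ left (NP.+-mono-≤ (NP.≤-trans middle (tent-bound γ)) right) ⟩
    tri a ℕ.+ (F ℕ.+ tri r)                            ≡⟨ cong (tri a ℕ.+_) (NP.+-comm F (tri r)) ⟩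
    tri a ℕ.+ (tri r ℕ.+ F)                            ≡⟨ sym (NP.+-assoc (tri a) (tri r) F) ⟩
    tri a ℕ.+ tri r ℕ.+ F                              ∎
    where
    open NP.≤-Reasoning
    h : ℕ → ℕ
    h k = ∣ g k ∣
    F b : ℕ
    F = ⌊ γ /2⌋ ℕ.* ⌈ γ /2⌉
    b = a ℕ.+ γ
    b≤m : b ℕ.≤ m
    b≤m = subst (b ℕ.≤_) a+γ+r≡m (NP.m≤m+n b r)
    a≤m : a ℕ.≤ m
    a≤m = NP.≤-trans (NP.m≤m+n a γ) b≤m
    m+1≡a+γ+r+1 : suc m ≡ a ℕ.+ (γ ℕ.+ suc r)
    m+1≡a+γ+r+1 = trans (cong suc (sym a+γ+r≡m))
      (trans (sym (NP.+-suc (a ℕ.+ γ) r)) (NP.+-assoc a γ (suc r)))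
    left : sumFrom h 0 a ℕ.≤ tri a
    left = subst (sumFrom h 0 a ℕ.≤_) (sumFrom-countdown 0 a)
      (sumFrom-mono h (a ∸_) 0 0 a (λ j j<a → below-zero a j ga (NP.<⇒≤ j<a) a≤m))
    middle : sumFrom h a γ ℕ.≤ tent γ
    middle = sumFrom-mono h (λ j → j ⊓ (γ ∸ j)) a 0 γ (λ j j<γ →
      let a+j≤b = NP.+-monoʳ-≤ a (NP.<⇒≤ j<γ) in
      NP.⊓-glb
        (subst (h (a ℕ.+ j) ℕ.≤_) (NP.m+n∸m≡n a j)
          (above-zero a (a ℕ.+ j) ga (NP.m≤m+n a j) (NP.≤-trans a+j≤b b≤m)))
        (subst (h (a ℕ.+ j) ℕ.≤_) (NP.[m+n]∸[m+o]≡n∸o a γ j)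
          (below-zero b (a ℕ.+ j) gb a+j≤b b≤m)))
    right : sumFrom h b (suc r) ℕ.≤ tri r
    right = subst (sumFrom h b (suc r) ℕ.≤_) (sumFrom-countup b r)
      (sumFrom-mono h (_∸ b) b b (suc r) (λ j j≤r →
        above-zero b (b ℕ.+ j) gb (NP.m≤m+n b j)
          (subst (b ℕ.+ j ℕ.≤_) a+γ+r≡m (NP.+-monoʳ-≤ b (NP.≤-pred j≤r)))))

partial : (ℕ → ℤ) → ℕ → ℤ
partial f zero    = 0ℤ
partial f (suc k) = partial f k ℤ.+ f (suc k)

prefixSum-partial : ∀ f k → prefixSum f (suc k) ≡ f 0 ℤ.+ partial f k
prefixSum-partial f zero    = trans (IP.+-identityˡ (f 0)) (sym (IP.+-identityʳ (f 0)))
prefixSum-partial f (suc k) =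
  trans (cong (ℤ._+ f (suc k)) (prefixSum-partial f k)) (IP.+-assoc (f 0) (partial f k) (f (suc k)))

partial-rangeSum : ∀ f a len → partial f (a ℕ.+ len) ≡ partial f a ℤ.+ rangeSum f (suc a) len
partial-rangeSum f a zero      = trans (cong (partial f) (NP.+-identityʳ a)) (sym (IP.+-identityʳ _))
partial-rangeSum f a (suc len) = begin
  partial f (a ℕ.+ suc len)                                     ≡⟨ cong (partial f) (NP.+-suc a len) ⟩
  partial f (suc a ℕ.+ len)                                     ≡⟨ partial-rangeSum f (suc a) len ⟩
  (partial f a ℤ.+ f (suc a)) ℤ.+ rangeSum f (suc (suc a)) len  ≡⟨ IP.+-assoc (partial f a) _ _ ⟩
  partial f a ℤ.+ rangeSum f (suc a) (suc len)                  ∎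
  where open ≡-Reasoning

partial-increment : ∀ f k → f (suc k) ≡ partial f (suc k) ℤ.- partial f k
partial-increment f k = sym (cancel (partial f k) (f (suc k)))
  where
  cancel : ∀ p x → (p ℤ.+ x) ℤ.- p ≡ x
  cancel = solve-∀

partial-+ : ∀ f g d k → (∀ i → 1 ℕ.≤ i → i ℕ.≤ k → f i ≡ g i ℤ.+ d i)
          → partial f k ≡ partial g k ℤ.+ partial d k
partial-+ f g d zero    split = refl
partial-+ f g d (suc k) split = begin
  partial f k ℤ.+ f (suc k)
    ≡⟨ cong₂ ℤ._+_ (partial-+ f g d k (λ i 1≤i i≤k → split i 1≤i (NP.m≤n⇒m≤1+n i≤k)))
                   (split (suc k) (s≤s z≤n) NP.≤-refl) ⟩
  (partial g k ℤ.+ partial d k) ℤ.+ (g (suc k) ℤ.+ d (suc k))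
    ≡⟨ interchange (partial g k) (partial d k) (g (suc k)) (d (suc k)) ⟩
  (partial g k ℤ.+ g (suc k)) ℤ.+ (partial d k ℤ.+ d (suc k)) ∎
  where
  open ≡-Reasoning
  interchange : ∀ a b c e → (a ℤ.+ b) ℤ.+ (c ℤ.+ e) ≡ (a ℤ.+ c) ℤ.+ (b ℤ.+ e)
  interchange = solve-∀

∣0 : ∀ q → q ∣ 0ℤ
∣0 q = DS.divides 0ℤ (sym (IP.*-zeroˡ q))

prefixSum-congruent : ∀ (q : ℤ) f g d N → (∀ i → i ℕ.< N → q ∣ (f i ℤ.- (g i ℤ.+ d i)))
                    → q ∣ (prefixSum f N ℤ.- (prefixSum g N ℤ.+ prefixSum d N))
prefixSum-congruent q f g d zero    _     = ∣0 q
prefixSum-congruent q f g d (suc N) termwise =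
  subst (q ∣_) (sym (regroup (prefixSum f N) (prefixSum g N) (prefixSum d N) (f N) (g N) (d N)))
    (DS.∣m∣n⇒∣m+n (prefixSum-congruent q f g d N (λ i i<N → termwise i (NP.m≤n⇒m≤1+n i<N)))
                  (termwise N NP.≤-refl))
  where
  regroup : ∀ a b c x y z → (a ℤ.+ x) ℤ.- ((b ℤ.+ y) ℤ.+ (c ℤ.+ z))
                          ≡ (a ℤ.- (b ℤ.+ c)) ℤ.+ (x ℤ.- (y ℤ.+ z))
  regroup = solve-∀

at-lookup : ∀ {N} (x : Fin N → ℤ) (j : Fin N) → at x (toℕ j) ≡ x j
at-lookup {N} x j with toℕ j ℕ.<? N
... | yes p = cong x (FP.fromℕ<-toℕ j p)
... | no ¬p = ⊥-elim (¬p (FP.toℕ<n j))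

coord-trit : ∀ {n m} (v : Vertex n m) t → 1 ℕ.≤ t → t ℕ.≤ m → Trit (at (coord v) t)
coord-trit {m = m} v (suc t) (s≤s z≤n) t<m =
  subst (λ k → Trit (at (coord v) (suc k))) index
    (subst Trit (sym (at-lookup (coord v) (F.suc (inject₁ i)))) (mid v i))
  where
  i : Fin m
  i = fromℕ< t<m
  index : toℕ (inject₁ i) ≡ t
  index = trans (FP.toℕ-inject₁ i) (FP.toℕ-fromℕ< t<m)

trit-abs : ∀ {x} → Trit x → ∣ x ∣ ℕ.≤ 1
trit-abs (inj₁ refl)        = NP.≤-refl
trit-abs (inj₂ (inj₁ refl)) = z≤n
trit-abs (inj₂ (inj₂ refl)) = NP.≤-refl

trit-pred : ∀ {x} → Trit x → 0ℤ ℤ.≤ x → Trit (x ℤ.+ -1ℤ)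
trit-pred (inj₁ refl)        ()
trit-pred (inj₂ (inj₁ refl)) _ = inj₁ refl
trit-pred (inj₂ (inj₂ refl)) _ = inj₂ (inj₁ refl)

trit-suc : ∀ {x} → Trit x → x ℤ.≤ 0ℤ → Trit (x ℤ.+ 1ℤ)
trit-suc (inj₁ refl)        _ = inj₂ (inj₁ refl)
trit-suc (inj₂ (inj₁ refl)) _ = inj₂ (inj₂ refl)
trit-suc (inj₂ (inj₂ refl)) (ℤ.+≤+ ())

rep-reduce : ∀ n .{{_ : NonZero n}} y → Rep n (+ (y %ℕ n))
rep-reduce n y = y %ℕ n , n%ℕd<d y n , refl

reduce-congruent : ∀ n .{{_ : NonZero n}} y → (+ n) ∣ (+ (y %ℕ n) ℤ.- y)
reduce-congruent n y = DS.divides (ℤ.- (y /ℕ n)) (begin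
  + (y %ℕ n) ℤ.- y                                  ≡⟨ cong (λ z → + (y %ℕ n) ℤ.- z) (a≡a%ℕn+[a/ℕn]*n y n) ⟩
  + (y %ℕ n) ℤ.- (+ (y %ℕ n) ℤ.+ (y /ℕ n) ℤ.* + n)  ≡⟨ cancel (+ (y %ℕ n)) (y /ℕ n) (+ n) ⟩
  ℤ.- (y /ℕ n) ℤ.* + n                              ∎)
  where
  open ≡-Reasoning
  cancel : ∀ r q d → r ℤ.- (r ℤ.+ q ℤ.* d) ≡ (ℤ.- q) ℤ.* d
  cancel = solve-∀

reduce-rep : ∀ n .{{_ : NonZero n}} x → Rep n x → + ((x ℤ.+ 0ℤ) %ℕ n) ≡ x
reduce-rep n x (k , k<n , refl) = cong +_ (trans (cong (ℕ._% n) (NP.+-identityʳ k)) (m<n⇒m%n≡m k<n))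

rep-divisible : ∀ n .{{_ : NonZero n}} x → Rep n x → (+ n) ∣ x → x ≡ 0ℤ
rep-divisible n x (zero  , k<n , refl) _   = refl
rep-divisible n x (suc k , k<n , refl) n∣x = ⊥-elim (NP.<⇒≱ k<n (ND.∣⇒≤ (DS.∣⇒∣ᵤ n∣x)))

select : ∀ {P : Set} → Dec P → ℤ → ℤ → ℤ
select (yes _) x y = x
select (no _)  x y = y

select-yes : ∀ {P : Set} (d : Dec P) {x y} → P → select d x y ≡ x
select-yes (yes _) p = refl
select-yes (no ¬p) p = ⊥-elim (¬p p)

select-no : ∀ {P : Set} (d : Dec P) {x y} → ¬ P → select d x y ≡ y
select-no (yes p) ¬p = ⊥-elim (¬p p)
select-no (no _)  ¬p = refl

select-elim : ∀ {P : Set} (Q : ℤ → Set) (d : Dec P) {x y} → (P → Q x) → (¬ P → Q y) → Q (select d x y)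
select-elim Q (yes p) onYes onNo = onYes p
select-elim Q (no ¬p) onYes onNo = onNo ¬p

unit : Sign → ℤ
unit s = s ◃ 1

either-direction : ∀ s {A : ℤ → ℤ → Set} → A (unit s) (ℤ.- unit s) → A 1ℤ -1ℤ ⊎ A -1ℤ 1ℤ
either-direction Sign.+ p = inj₁ p
either-direction Sign.- p = inj₂ p

-- Moving the unit ε = unit s from coordinate c to coordinate c+1 of v (c ≤ m).
module Transfer (n m : ℕ) .{{_ : NonZero n}} (v : Vertex n m) (c : ℕ) (c≤m : c ℕ.≤ m) (s : Sign) where

  u : ℕ → ℤ
  u = at (coord v)

  ε : ℤ
  ε = unit s

  change : ℕ → ℤ
  change i = select (i ℕ.≟ c) (ℤ.- ε) 0ℤ ℤ.+ select (i ℕ.≟ suc c) ε 0ℤ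

  prefixChange : ℕ → ℤ
  prefixChange N = select (N ℕ.≟ suc c) (ℤ.- ε) 0ℤ

  reduce : ℤ → ℤ
  reduce y = + (y %ℕ n)

  -- the end coordinates live in ℤ_n and are reduced back to representatives
  reduceEnd : ℕ → ℤ → ℤ
  reduceEnd i y = select (i ℕ.≟ 0) (reduce y) (select (i ℕ.≟ suc m) (reduce y) y)

  moved : ℕ → ℤ → ℤ
  moved i x = reduceEnd i (x ℤ.+ change i)

  newCoord : Fin (suc (suc m)) → ℤ
  newCoord j = moved (toℕ j) (coord v j)

  c≢c+1 : c ≢ suc c
  c≢c+1 e = NP.1+n≢n (sym e)

  change-at-c : change c ≡ ℤ.- ε
  change-at-c rewrite select-yes (c ℕ.≟ c) {ℤ.- ε} {0ℤ} refl
                    | select-no (c ℕ.≟ suc c) {ε} {0ℤ} c≢c+1 = IP.+-identityʳ _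

  change-at-suc-c : change (suc c) ≡ ε
  change-at-suc-c rewrite select-no (suc c ℕ.≟ c) {ℤ.- ε} {0ℤ} NP.1+n≢n
                        | select-yes (suc c ℕ.≟ suc c) {ε} {0ℤ} refl = IP.+-identityˡ _

  change-elsewhere : ∀ i → i ≢ c → i ≢ suc c → change i ≡ 0ℤ
  change-elsewhere i i≢c i≢c+1 rewrite select-no (i ℕ.≟ c) {ℤ.- ε} {0ℤ} i≢c
                                     | select-no (i ℕ.≟ suc c) {ε} {0ℤ} i≢c+1 = refl

  prefixSum-change : ∀ N → prefixSum change N ≡ prefixChange N
  prefixSum-change zero = sym (select-no (0 ℕ.≟ suc c) {ℤ.- ε} {0ℤ} (λ ()))
  prefixSum-change (suc N) with toSum (N ℕ.≟ c)
  ... | inj₁ refl = begin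
    prefixSum change c ℤ.+ change c ≡⟨ cong₂ ℤ._+_ (prefixSum-change c) change-at-c ⟩
    prefixChange c ℤ.+ ℤ.- ε       ≡⟨ cong (ℤ._+ ℤ.- ε) (select-no (c ℕ.≟ suc c) c≢c+1) ⟩
    0ℤ ℤ.+ ℤ.- ε                   ≡⟨ IP.+-identityˡ _ ⟩
    ℤ.- ε                          ≡⟨ sym (select-yes (suc c ℕ.≟ suc c) refl) ⟩
    prefixChange (suc c)           ∎
    where open ≡-Reasoning
  ... | inj₂ N≢c with toSum (N ℕ.≟ suc c)
  ...   | inj₁ refl = begin
    prefixSum change (suc c) ℤ.+ change (suc c) ≡⟨ cong₂ ℤ._+_ (prefixSum-change (suc c)) change-at-suc-c ⟩
    prefixChange (suc c) ℤ.+ ε                  ≡⟨ cong (ℤ._+ ε) (select-yes (suc c ℕ.≟ suc c) refl) ⟩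
    ℤ.- ε ℤ.+ ε                                 ≡⟨ IP.+-inverseˡ ε ⟩
    0ℤ                                          ≡⟨ sym (select-no (suc (suc c) ℕ.≟ suc c) NP.1+n≢n) ⟩
    prefixChange (suc (suc c))                  ∎
    where open ≡-Reasoning
  ...   | inj₂ N≢c+1 = begin
    prefixSum change N ℤ.+ change N ≡⟨ cong₂ ℤ._+_ (prefixSum-change N) (change-elsewhere N N≢c N≢c+1) ⟩
    prefixChange N ℤ.+ 0ℤ           ≡⟨ cong (ℤ._+ 0ℤ) (select-no (N ℕ.≟ suc c) N≢c+1) ⟩
    0ℤ                              ≡⟨ sym (select-no (suc N ℕ.≟ suc c) (λ e → N≢c (NP.suc-injective e))) ⟩
    prefixChange (suc N)            ∎
    where open ≡-Reasoning

  moved-congruent : ∀ i x → (+ n) ∣ (moved i x ℤ.- (x ℤ.+ change i))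
  moved-congruent i x =
    select-elim P (i ℕ.≟ 0) (λ _ → reduce-congruent n y)
      (λ _ → select-elim P (i ℕ.≟ suc m) (λ _ → reduce-congruent n y)
               (λ _ → subst ((+ n) ∣_) (sym (IP.+-inverseʳ y)) (∣0 (+ n))))
    where
    y : ℤ
    y = x ℤ.+ change i
    P : ℤ → Set
    P z = (+ n) ∣ (z ℤ.- y)

  moved-interior : ∀ i x → i ≢ 0 → i ≢ suc m → moved i x ≡ x ℤ.+ change i
  moved-interior i x i≢0 i≢m+1 =
    trans (select-no (i ℕ.≟ 0) i≢0) (select-no (i ℕ.≟ suc m) i≢m+1)

  reduceEnd-rep : ∀ i y → (i ≡ 0 ⊎ i ≡ suc m) → Rep n (reduceEnd i y)
  reduceEnd-rep i y end =
    select-elim (Rep n) (i ℕ.≟ 0) (λ _ → rep-reduce n y)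
      (λ i≢0 → select-elim (Rep n) (i ℕ.≟ suc m) (λ _ → rep-reduce n y) (λ i≢m+1 → ⊥-elim (interior i≢0 i≢m+1 end)))
    where
    interior : i ≢ 0 → i ≢ suc m → ¬ (i ≡ 0 ⊎ i ≡ suc m)
    interior i≢0 _      (inj₁ i≡0)   = i≢0 i≡0
    interior _ i≢m+1 (inj₂ i≡m+1) = i≢m+1 i≡m+1

  -- Coordinates away from c, c+1 do not move (end coordinates are already reduced).
  moved-untouched : ∀ i x → i ≢ c → i ≢ suc c → (i ≡ 0 → Rep n x) → (i ≡ suc m → Rep n x)
                  → moved i x ≡ x
  moved-untouched i x i≢c i≢c+1 rep₀ rep₁ rewrite change-elsewhere i i≢c i≢c+1 =
    select-elim (_≡ x) (i ℕ.≟ 0) (λ i≡0 → reduce-rep n x (rep₀ i≡0))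
      (λ _ → select-elim (_≡ x) (i ℕ.≟ suc m) (λ i≡m+1 → reduce-rep n x (rep₁ i≡m+1))
               (λ _ → IP.+-identityʳ x))

  at-newCoord : ∀ i → i ℕ.< suc (suc m) → at newCoord i ≡ moved i (u i)
  at-newCoord i i<m+2 = subst (λ k → at newCoord k ≡ moved k (u k)) (FP.toℕ-fromℕ< i<m+2)
    (trans (at-lookup newCoord j) (cong (moved (toℕ j)) (sym (at-lookup (coord v) j))))
    where
    j : Fin (suc (suc m))
    j = fromℕ< i<m+2

  prefixSum-newCoord : ∀ N → N ℕ.≤ suc (suc m)
    → (+ n) ∣ (prefixSum (at newCoord) N ℤ.- (prefixSum u N ℤ.+ prefixChange N))
  prefixSum-newCoord N N≤m+2 =
    subst (λ z → (+ n) ∣ (prefixSum (at newCoord) N ℤ.- (prefixSum u N ℤ.+ z))) (prefixSum-change N)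
      (prefixSum-congruent (+ n) (at newCoord) u change N (λ i i<N →
        subst (λ z → (+ n) ∣ (z ℤ.- (u i ℤ.+ change i))) (sym (at-newCoord i (NP.<-≤-trans i<N N≤m+2)))
          (moved-congruent i (u i))))

  pivot-preserved : ∀ N → N ℕ.≤ suc (suc m) → N ≢ suc c
    → (+ n) ∣ prefixSum u N → (+ n) ∣ prefixSum (at newCoord) N
  pivot-preserved N N≤m+2 N≢c+1 n∣old =
    subst ((+ n) ∣_) (cancel (prefixSum (at newCoord) N) (prefixSum u N)) (DS.∣m∣n⇒∣m+n n∣diff n∣old)
    where
    cancel : ∀ x y → (x ℤ.- (y ℤ.+ 0ℤ)) ℤ.+ y ≡ x
    cancel = solve-∀
    n∣diff : (+ n) ∣ (prefixSum (at newCoord) N ℤ.- (prefixSum u N ℤ.+ 0ℤ))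
    n∣diff = subst (λ z → (+ n) ∣ (prefixSum (at newCoord) N ℤ.- (prefixSum u N ℤ.+ z)))
               (select-no (N ℕ.≟ suc c) N≢c+1) (prefixSum-newCoord N N≤m+2)

  partial-newCoord : ∀ k → k ℕ.≤ m → partial (at newCoord) k ≡ partial u k ℤ.+ partial change k
  partial-newCoord k k≤m = partial-+ (at newCoord) u change k (λ i 1≤i i≤k →
    let i≤m = NP.≤-trans i≤k k≤m in
    trans (at-newCoord i (s≤s (NP.m≤n⇒m≤1+n i≤m)))
          (moved-interior i (u i) (λ i≡0 → NP.<⇒≢ 1≤i (sym i≡0)) (NP.<⇒≢ (s≤s i≤m))))

  relative-partial : ∀ a k → a ℕ.≤ m → k ℕ.≤ m → a ≢ c
    → partial (at newCoord) k ℤ.- partial (at newCoord) a ≡ (partial u k ℤ.- partial u a) ℤ.+ prefixChange (suc k)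
  relative-partial a k a≤m k≤m a≢c
    rewrite partial-newCoord k k≤m | partial-newCoord a a≤m =
    shift (partial u k) (partial u a) (partial change k) (partial change a) (change 0) (prefixChange (suc k))
      (through k) (trans (through a) (select-no (suc a ℕ.≟ suc c) (λ e → a≢c (NP.suc-injective e))))
    where
    through : ∀ j → change 0 ℤ.+ partial change j ≡ prefixChange (suc j)
    through j = trans (sym (prefixSum-partial change j)) (prefixSum-change (suc j))
    regroup : ∀ tk ta x y d₀ → (tk ℤ.+ x) ℤ.- (ta ℤ.+ y) ≡ ((tk ℤ.- ta) ℤ.+ (d₀ ℤ.+ x)) ℤ.- (d₀ ℤ.+ y)
    regroup = solve-∀
    shift : ∀ tk ta x y d₀ p → d₀ ℤ.+ x ≡ p → d₀ ℤ.+ y ≡ 0ℤ → (tk ℤ.+ x) ℤ.- (ta ℤ.+ y) ≡ (tk ℤ.- ta) ℤ.+ p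
    shift tk ta x y d₀ p hx hy =
      trans (regroup tk ta x y d₀) (trans (cong₂ (λ z w → ((tk ℤ.- ta) ℤ.+ z) ℤ.- w) hx hy) (IP.+-identityʳ _))

  module Target (trit-c   : 1 ℕ.≤ c → Trit (u c ℤ.+ ℤ.- ε))
                (trit-c+1 : suc c ℕ.≤ m → Trit (u (suc c) ℤ.+ ε)) where

    moved-trit : ∀ t x → 1 ℕ.≤ t → t ℕ.≤ m → Trit x → x ≡ u t → Trit (moved t x)
    moved-trit t x 1≤t t≤m trit-x x≡ut
      rewrite moved-interior t x (λ t≡0 → NP.<⇒≢ 1≤t (sym t≡0)) (NP.<⇒≢ (s≤s t≤m))
      with toSum (t ℕ.≟ c)
    ... | inj₁ refl rewrite change-at-c | x≡ut = trit-c 1≤t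
    ... | inj₂ t≢c with toSum (t ℕ.≟ suc c)
    ...   | inj₁ refl rewrite change-at-suc-c | x≡ut = trit-c+1 t≤m
    ...   | inj₂ t≢c+1 rewrite change-elsewhere t t≢c t≢c+1 | IP.+-identityʳ x = trit-x

    target : Vertex n m
    target = record
      { coord = newCoord
      ; first = reduceEnd-rep 0 (coord v F.zero ℤ.+ change 0) (inj₁ refl)
      ; last  = reduceEnd-rep (toℕ (fromℕ (suc m))) _ (inj₂ (FP.toℕ-fromℕ (suc m)))
      ; mid   = λ i → moved-trit (suc (toℕ (inject₁ i))) _ (s≤s z≤n)
                  (subst (λ z → suc z ℕ.≤ m) (sym (FP.toℕ-inject₁ i)) (FP.toℕ<n i))
                  (mid v i) (sym (at-lookup (coord v) (F.suc (inject₁ i))))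
      ; sum≡0 = DS.∣⇒∣ᵤ (pivot-preserved (suc (suc m)) NP.≤-refl
                  (λ e → NP.<⇒≢ (s≤s c≤m) (sym (NP.suc-injective e))) (DS.∣ᵤ⇒∣ (sum≡0 v)))
      }

    edge : Fin (suc m)
    edge = fromℕ< (s≤s c≤m)

    toℕ-edge : toℕ edge ≡ c
    toℕ-edge = FP.toℕ-fromℕ< (s≤s c≤m)

    shifted : ∀ (j : Fin (suc (suc m))) t → change (toℕ j) ≡ ℤ.- t → Shift n m j (coord v j) (newCoord j) t
    shifted j t change≡ = atEnd , inside
      where
      x : ℤ
      x = coord v j
      flip : ∀ a b t → ℤ.- (a ℤ.- (b ℤ.+ ℤ.- t)) ≡ b ℤ.- (a ℤ.+ t)
      flip = solve-∀
      undo : ∀ x t → (x ℤ.+ ℤ.- t) ℤ.+ t ≡ x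
      undo = solve-∀
      atEnd : IsEnd m j → (+ n) DU.∣ (x ℤ.- (newCoord j ℤ.+ t))
      atEnd _ = DS.∣⇒∣ᵤ (subst ((+ n) ∣_) (flip (newCoord j) x t)
        (DS.∣m⇒∣-m (subst (λ z → (+ n) ∣ (newCoord j ℤ.- (x ℤ.+ z))) change≡ (moved-congruent (toℕ j) x))))
      inside : ¬ IsEnd m j → x ≡ newCoord j ℤ.+ t
      inside interior = trans (sym (undo x t)) (cong (ℤ._+ t) (sym
        (trans (moved-interior (toℕ j) x (λ e → interior (inj₁ e)) (λ e → interior (inj₂ e)))
               (cong (λ z → x ℤ.+ z) change≡))))

    unchanged : ∀ j → j ≢ inject₁ edge → j ≢ F.suc edge → coord v j ≡ newCoord j
    unchanged j j≢c j≢c+1 = sym (moved-untouched (toℕ j) (coord v j) ≢c ≢c+1 rep₀ rep₁)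
      where
      ≢c : toℕ j ≢ c
      ≢c e = j≢c (FP.toℕ-injective (trans e (sym (trans (FP.toℕ-inject₁ edge) toℕ-edge))))
      ≢c+1 : toℕ j ≢ suc c
      ≢c+1 e = j≢c+1 (FP.toℕ-injective (trans e (sym (cong suc toℕ-edge))))
      rep₀ : toℕ j ≡ 0 → Rep n (coord v j)
      rep₀ e = subst (λ z → Rep n (coord v z)) (sym (FP.toℕ-injective {i = j} {j = F.zero} e)) (first v)
      rep₁ : toℕ j ≡ suc m → Rep n (coord v j)
      rep₁ e = subst (λ z → Rep n (coord v z))
        (sym (FP.toℕ-injective {i = j} {j = fromℕ (suc m)} (trans e (sym (FP.toℕ-fromℕ (suc m))))))
        (last v)

    adjacent : Adj v target
    adjacent = edge , unchanged ,
      either-direction s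
        {λ t₁ t₂ → Shift n m (inject₁ edge) (coord v (inject₁ edge)) (newCoord (inject₁ edge)) t₁
                 × Shift n m (F.suc edge) (coord v (F.suc edge)) (newCoord (F.suc edge)) t₂}
        (shifted (inject₁ edge) ε at-c , shifted (F.suc edge) (ℤ.- ε) at-c+1)
      where
      at-c : change (toℕ (inject₁ edge)) ≡ ℤ.- ε
      at-c = trans (cong change (trans (FP.toℕ-inject₁ edge) toℕ-edge)) change-at-c
      at-c+1 : change (suc (toℕ edge)) ≡ ℤ.- (ℤ.- ε)
      at-c+1 = trans (cong (λ z → change (suc z)) toℕ-edge) (trans change-at-suc-c (sym (IP.neg-involutive _)))

-- A vertex whose partial sums vanish on [0, m] and whose first coordinate is
-- divisible by n is the zero vertex (the last coordinate is then forced).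
vanishing-partials : ∀ {n m} .{{_ : NonZero n}} (v : Vertex n m)
  → (∀ k → k ℕ.≤ m → partial (at (coord v)) k ≡ 0ℤ) → (+ n) ∣ at (coord v) 0 → IsZero v
vanishing-partials {n} {m} v partial≡0 n∣u₀ j =
  trans (sym (at-lookup (coord v) j)) (vanish (toℕ j) (FP.toℕ<n j))
  where
  u : ℕ → ℤ
  u = at (coord v)
  first≡0 : u 0 ≡ 0ℤ
  first≡0 = rep-divisible n (u 0) (first v) n∣u₀
  interior≡0 : ∀ k → suc k ℕ.≤ m → u (suc k) ≡ 0ℤ
  interior≡0 k k<m = trans (partial-increment u k)
    (cong₂ ℤ._-_ (partial≡0 (suc k) k<m) (partial≡0 k (NP.<⇒≤ k<m)))
  total : prefixSum u (suc (suc m)) ≡ u (suc m)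
  total = begin
    prefixSum u (suc (suc m))           ≡⟨ prefixSum-partial u (suc m) ⟩
    u 0 ℤ.+ (partial u m ℤ.+ u (suc m)) ≡⟨ cong₂ (λ p q → p ℤ.+ (q ℤ.+ u (suc m))) first≡0 (partial≡0 m NP.≤-refl) ⟩
    0ℤ ℤ.+ (0ℤ ℤ.+ u (suc m))           ≡⟨ trans (IP.+-identityˡ _) (IP.+-identityˡ _) ⟩
    u (suc m)                           ∎
    where open ≡-Reasoning
  last≡0 : u (suc m) ≡ 0ℤ
  last≡0 = rep-divisible n (u (suc m))
    (subst (Rep n) (trans (sym (at-lookup (coord v) (fromℕ (suc m)))) (cong u (FP.toℕ-fromℕ (suc m)))) (last v))
    (subst ((+ n) ∣_) total (DS.∣ᵤ⇒∣ (sum≡0 v)))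
  vanish : ∀ t → t ℕ.< suc (suc m) → u t ≡ 0ℤ
  vanish zero    _ = first≡0
  vanish (suc k) (s≤s k≤m+1) with NP.m≤n⇒m<n∨m≡n k≤m+1
  ... | inj₁ k<m+1 = interior≡0 k (NP.≤-pred k<m+1)
  ... | inj₂ refl  = last≡0

zero-or-signed : ∀ x → x ≡ 0ℤ ⊎ Σ Sign λ s → Σ ℕ λ M → x ≡ s ◃ suc M
zero-or-signed (+ zero)  = inj₁ refl
zero-or-signed (+ suc M) = inj₂ (Sign.+ , M , refl)
zero-or-signed -[1+ M ]  = inj₂ (Sign.- , M , refl)

bounds-of-abs : ∀ y M → ∣ y ∣ ℕ.≤ M → (y ℤ.≤ + M) × (ℤ.- (+ M) ℤ.≤ y)
bounds-of-abs (+ k)    M       k≤M       = ℤ.+≤+ k≤M , IP.neg-≤-pos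
bounds-of-abs -[1+ k ] (suc M) (s≤s k≤M) = ℤ.-≤+ , ℤ.-≤- k≤M

-- If x = s(M+1) - y with |y| ≤ M+1, then x has sign s (weakly), so moving a trit x
-- one unit against s keeps it a trit.
trit-toward : ∀ s M x y → Trit x → ∣ y ∣ ℕ.≤ suc M → x ≡ (s ◃ suc M) ℤ.- y → Trit (x ℤ.+ ℤ.- unit s)
trit-toward Sign.+ M x y trit-x |y|≤ refl = trit-pred trit-x (IP.i≤j⇒0≤j-i (proj₁ (bounds-of-abs y (suc M) |y|≤)))
trit-toward Sign.- M x y trit-x |y|≤ refl = trit-suc trit-x (IP.i≤j⇒i-j≤0 (proj₂ (bounds-of-abs y (suc M) |y|≤)))

trit-away : ∀ s M x y → Trit x → ∣ y ∣ ℕ.≤ suc M → x ≡ y ℤ.- (s ◃ suc M) → Trit (x ℤ.+ unit s)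
trit-away Sign.+ M x y trit-x |y|≤ refl = trit-suc trit-x (IP.i≤j⇒i-j≤0 (proj₁ (bounds-of-abs y (suc M) |y|≤)))
trit-away Sign.- M x y trit-x |y|≤ refl = trit-pred trit-x (IP.i≤j⇒0≤j-i (proj₂ (bounds-of-abs y (suc M) |y|≤)))

signed≢0 : ∀ s M → s ◃ suc M ≢ 0ℤ
signed≢0 Sign.+ M ()
signed≢0 Sign.- M ()

abs-toward-zero : ∀ s M → suc ∣ (s ◃ suc M) ℤ.+ ℤ.- unit s ∣ ≡ suc M
abs-toward-zero Sign.+ M       = refl
abs-toward-zero Sign.- zero    = refl
abs-toward-zero Sign.- (suc M) = refl

module Descent (n m a : ℕ) .{{_ : NonZero n}} (a≤m : a ℕ.≤ m) where

  disc : Vertex n m → ℕ → ℤ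
  disc v k = partial (at (coord v)) k ℤ.- partial (at (coord v)) a

  potential : Vertex n m → ℕ
  potential v = sumFrom (λ k → ∣ disc v k ∣) 0 (suc m)

  PivotAt : Vertex n m → Set
  PivotAt v = (+ n) ∣ prefixSum (at (coord v)) (suc a)

  -- Discrepancies move by the interior coordinates, hence by at most one per step.
  disc-increment : ∀ v k → at (coord v) (suc k) ≡ disc v (suc k) ℤ.- disc v k
  disc-increment v k = trans (partial-increment (at (coord v)) k)
    (sym (cancel (partial (at (coord v)) (suc k)) (partial (at (coord v)) k) (partial (at (coord v)) a)))
    where
    cancel : ∀ x y z → (x ℤ.- z) ℤ.- (y ℤ.- z) ≡ x ℤ.- y
    cancel = solve-∀

  disc-lipschitz : ∀ v → Lipschitz (disc v) m
  disc-lipschitz v k k<m = subst (λ y → ∣ y ∣ ℕ.≤ 1) (disc-increment v k)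
    (trit-abs (coord-trit v (suc k) (s≤s z≤n) k<m))

  no-discrepancy : ∀ v → PivotAt v → (∀ k → k ℕ.≤ m → disc v k ≡ 0ℤ) → IsZero v
  no-discrepancy v pivot disc≡0 = vanishing-partials v partial≡0 n∣u₀
    where
    u : ℕ → ℤ
    u = at (coord v)
    partial-a≡0 : partial u a ≡ 0ℤ
    partial-a≡0 = trans (sym (IP.neg-involutive _)) (cong ℤ.-_ (trans (sym (IP.+-identityˡ _)) (disc≡0 0 z≤n)))
    partial≡0 : ∀ k → k ℕ.≤ m → partial u k ≡ 0ℤ
    partial≡0 k k≤m = trans (sym (IP.+-identityʳ _))
      (trans (cong (λ z → partial u k ℤ.- z) (sym partial-a≡0)) (disc≡0 k k≤m))
    n∣u₀ : (+ n) ∣ u 0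
    n∣u₀ = subst ((+ n) ∣_)
      (trans (prefixSum-partial u a) (trans (cong (λ z → u 0 ℤ.+ z) partial-a≡0) (IP.+-identityʳ _))) pivot

  descent-step : ∀ v c → c ℕ.≤ m → (∀ k → k ℕ.≤ m → ∣ disc v k ∣ ℕ.≤ ∣ disc v c ∣)
    → ∀ s M → disc v c ≡ s ◃ suc M → PivotAt v
    → Σ (Vertex n m) λ w → Adj v w × suc (potential w) ℕ.≤ potential v × PivotAt w
  descent-step v c c≤m maximal s M disc-c pivot =
    T.target , T.adjacent , drop , pivot-preserved (suc a) (s≤s (NP.m≤n⇒m≤1+n a≤m)) (λ e → a≢c (NP.suc-injective e)) pivot
    where
    open Transfer n m v c c≤m s
    bounded : ∀ k → k ℕ.≤ m → ∣ disc v k ∣ ℕ.≤ suc M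
    bounded k k≤m = subst (∣ disc v k ∣ ℕ.≤_) (trans (cong ∣_∣ disc-c) (IP.abs-◃ s (suc M))) (maximal k k≤m)
    a≢c : a ≢ c
    a≢c refl = signed≢0 s M (trans (sym disc-c) (IP.+-inverseʳ (partial u a)))
    trit-c : 1 ℕ.≤ c → Trit (u c ℤ.+ ℤ.- ε)
    trit-c 1≤c = into-peak c 1≤c c≤m disc-c
      where
      into-peak : ∀ c′ → 1 ℕ.≤ c′ → c′ ℕ.≤ m → disc v c′ ≡ s ◃ suc M → Trit (u c′ ℤ.+ ℤ.- ε)
      into-peak (suc b) (s≤s z≤n) c′≤m disc-c′ =
        trit-toward s M (u (suc b)) (disc v b) (coord-trit v (suc b) (s≤s z≤n) c′≤m) (bounded b (NP.<⇒≤ c′≤m))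
          (trans (disc-increment v b) (cong (ℤ._- disc v b) disc-c′))
    trit-c+1 : suc c ℕ.≤ m → Trit (u (suc c) ℤ.+ ε)
    trit-c+1 c<m = trit-away s M (u (suc c)) (disc v (suc c)) (coord-trit v (suc c) (s≤s z≤n) c<m) (bounded (suc c) c<m)
      (trans (disc-increment v c) (cong (λ z → disc v (suc c) ℤ.- z) disc-c))
    module T = Target trit-c trit-c+1
    new-disc : ∀ k → k ℕ.≤ m → disc T.target k ≡ disc v k ℤ.+ prefixChange (suc k)
    new-disc k k≤m = relative-partial a k a≤m k≤m a≢c
    elsewhere : ∀ k → 0 ℕ.≤ k → k ℕ.< suc m → k ≢ c → ∣ disc T.target k ∣ ≡ ∣ disc v k ∣
    elsewhere k _ k<m+1 k≢c = cong ∣_∣ (begin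
      disc T.target k                    ≡⟨ new-disc k (NP.≤-pred k<m+1) ⟩
      disc v k ℤ.+ prefixChange (suc k)  ≡⟨ cong (λ z → disc v k ℤ.+ z) (select-no (suc k ℕ.≟ suc c) (λ e → k≢c (NP.suc-injective e))) ⟩
      disc v k ℤ.+ 0ℤ                    ≡⟨ IP.+-identityʳ (disc v k) ⟩
      disc v k                           ∎)
      where open ≡-Reasoning
    at-peak : suc ∣ disc T.target c ∣ ≡ ∣ disc v c ∣
    at-peak = begin
      suc ∣ disc T.target c ∣                 ≡⟨ cong (λ z → suc ∣ z ∣) (new-disc c c≤m) ⟩
      suc ∣ disc v c ℤ.+ prefixChange (suc c) ∣ ≡⟨ cong (λ z → suc ∣ z ∣) (cong₂ ℤ._+_ disc-c (select-yes (suc c ℕ.≟ suc c) refl)) ⟩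
      suc ∣ (s ◃ suc M) ℤ.+ ℤ.- ε ∣            ≡⟨ abs-toward-zero s M ⟩
      suc M                                   ≡⟨ sym (IP.abs-◃ s (suc M)) ⟩
      ∣ s ◃ suc M ∣                           ≡⟨ cong ∣_∣ (sym disc-c) ⟩
      ∣ disc v c ∣                            ∎
      where open ≡-Reasoning
    drop : suc (potential T.target) ℕ.≤ potential v
    drop = sumFrom-drop (λ k → ∣ disc v k ∣) (λ k → ∣ disc T.target k ∣) c 0 (suc m)
             elsewhere at-peak z≤n (s≤s c≤m)

  descend : ∀ B v → potential v ℕ.≤ B → PivotAt v → DistZero≤ v B
  descend B v bound pivot with argmax (λ k → ∣ disc v k ∣) m
  ... | c , c≤m , maximal with zero-or-signed (disc v c)
  ...   | inj₁ disc-c≡0 = 0 , z≤n , here (no-discrepancy v pivot (λ k k≤m →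
            IP.∣i∣≡0⇒i≡0 (NP.n≤0⇒n≡0 (subst (∣ disc v k ∣ ℕ.≤_) (cong ∣_∣ disc-c≡0) (maximal k k≤m)))))
  ...   | inj₂ (s , M , disc-c) = continue B bound (descent-step v c c≤m maximal s M disc-c pivot)
    where
    continue : ∀ B → potential v ℕ.≤ B
      → Σ (Vertex n m) (λ w → Adj v w × suc (potential w) ℕ.≤ potential v × PivotAt w) → DistZero≤ v B
    continue zero    bound (w , _ , drop , _) = ⊥-elim (NP.<⇒≱ (NP.<-≤-trans (s≤s z≤n) drop) bound)
    continue (suc B) bound (w , edge , drop , pivot′) with descend B w (NP.≤-pred (NP.≤-trans drop bound)) pivot′
    ... | k , k≤B , walk = suc k , s≤s k≤B , step edge walk

distance-bound : ∀ n m .{{_ : NonZero n}} (v : Vertex n m) a b → a ℕ.≤ b → b ℕ.≤ m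
  → (+ n) ∣ prefixSum (at (coord v)) (suc a)
  → rangeSum (at (coord v)) (suc a) (b ∸ a) ≡ 0ℤ
  → DistZero≤ v (tri a ℕ.+ tri (m ∸ b) ℕ.+ ⌊ b ∸ a /2⌋ ℕ.* ⌈ b ∸ a /2⌉)
distance-bound n m v a b a≤b b≤m pivot central =
  descend _ v (two-zeros-bound {g = disc v} (disc-lipschitz v) a (b ∸ a) (m ∸ b) a+γ+r≡m disc-a disc-b) pivot
  where
  open Descent n m a (NP.≤-trans a≤b b≤m)
  u : ℕ → ℤ
  u = at (coord v)
  a+γ+r≡m : a ℕ.+ (b ∸ a) ℕ.+ (m ∸ b) ≡ m
  a+γ+r≡m = trans (cong (ℕ._+ (m ∸ b)) (NP.m+[n∸m]≡n a≤b)) (NP.m+[n∸m]≡n b≤m)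
  disc-a : disc v a ≡ 0ℤ
  disc-a = IP.+-inverseʳ (partial u a)
  disc-b : disc v (a ℕ.+ (b ∸ a)) ≡ 0ℤ
  disc-b = begin
    partial u (a ℕ.+ (b ∸ a)) ℤ.- partial u a                           ≡⟨ cong (ℤ._- partial u a) (partial-rangeSum u a (b ∸ a)) ⟩
    (partial u a ℤ.+ rangeSum u (suc a) (b ∸ a)) ℤ.- partial u a        ≡⟨ cong (λ z → (partial u a ℤ.+ z) ℤ.- partial u a) central ⟩
    (partial u a ℤ.+ 0ℤ) ℤ.- partial u a                                ≡⟨ cong (ℤ._- partial u a) (IP.+-identityʳ (partial u a)) ⟩
    partial u a ℤ.- partial u a                                         ≡⟨ IP.+-inverseʳ (partial u a) ⟩
    0ℤ                                                                  ∎
    where open ≡-Reasoning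

-- p_l and p_r are natural numbers a ≤ b ≤ m: p_r ≥ m/2 ≥ 0 and p_l < m/2 ≤ p_r, and
-- I_c = [p_l+1, p_r] ⊆ [1, m] rules out p_l < 0 (I_c would contain p_l+1 ≤ 0).
central-interval : ∀ {n m} (v : Vertex n m) pl pr → IsPl v pl → IsPr v pr
  → (∀ i → pl ℤ.+ 1ℤ ℤ.≤ i → i ℤ.≤ pr → (1ℤ ℤ.≤ i) × (i ℤ.≤ + m))
  → Σ ℕ λ a → Σ ℕ λ b → pl ≡ + a × pr ≡ + b × a ℕ.≤ b × b ℕ.≤ m
central-interval v pl -[1+ _ ] _ (_ , () , _) _
central-interval v -[1+ zero ] (+ b) _ _ inside with proj₁ (inside 0ℤ IP.≤-refl (ℤ.+≤+ z≤n))
... | ℤ.+≤+ ()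
central-interval v -[1+ suc x ] (+ b) _ _ inside with proj₁ (inside -[1+ x ] IP.≤-refl ℤ.-≤+)
... | ()
central-interval {m = m} v (+ a) (+ b) (_ , 2a<m , _) (_ , m≤2b , _) inside =
  a , b , refl , refl , NP.<⇒≤ a<b , b≤m
  where
  a<b : a ℕ.< b
  a<b = NP.*-cancelˡ-< 2 a b (NP.<-≤-trans
    (IP.drop‿+<+ (subst (ℤ._< + m) (IP.+◃n≡+n (2 ℕ.* a)) 2a<m))
    (IP.drop‿+≤+ (subst (+ m ℤ.≤_) (IP.+◃n≡+n (2 ℕ.* b)) m≤2b)))
  b≤m : b ℕ.≤ m
  b≤m = IP.drop‿+≤+ (proj₂ (inside (+ b) (ℤ.+≤+ (subst (ℕ._≤ b) (NP.+-comm 1 a) a<b)) IP.≤-refl))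

∣+m-+n∣ : ∀ m n → n ℕ.≤ m → ∣ + m ℤ.- + n ∣ ≡ m ∸ n
∣+m-+n∣ m n n≤m = cong ∣_∣ (trans (IP.m-n≡m⊖n m n) (IP.⊖-≥ n≤m))

lemma5p28 : (n m : ℕ) → 1 ℕ.< n → n ℕ.≤ m → (v : Vertex n m)
    → (pl pr : ℤ) → IsPl v pl → IsPr v pr
    → (∀ i → pl ℤ.+ 1ℤ ℤ.≤ i → i ℤ.≤ pr → (1ℤ ℤ.≤ i) × (i ℤ.≤ + m))
    → rangeSum (at (coord v)) (∣ pl ℤ.+ 1ℤ ∣) (∣ pr ℤ.- pl ∣) ≡ 0ℤ
    → DistZero≤ v (tri (∣ pl ∣) ℕ.+ tri (∣ + m ℤ.- pr ∣)
        ℕ.+ ⌊ ∣ pr ℤ.- pl ∣ /2⌋ ℕ.* ⌈ ∣ pr ℤ.- pl ∣ /2⌉)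
lemma5p28 (suc n) m _ _ v pl pr isPl isPr inside central
  with central-interval v pl pr isPl isPr inside
... | a , b , refl , refl , a≤b , b≤m =
  subst (DistZero≤ v) (cong₂ bound (sym (∣+m-+n∣ m b b≤m)) (sym (∣+m-+n∣ b a a≤b)))
    (distance-bound (suc n) m v a b a≤b b≤m pivot central′)
  where
  bound : ℕ → ℕ → ℕ
  bound r γ = tri a ℕ.+ tri r ℕ.+ ⌊ γ /2⌋ ℕ.* ⌈ γ /2⌉
  pivot : (+ suc n) ∣ prefixSum (at (coord v)) (suc a)
  pivot = DS.∣ᵤ⇒∣ (subst (λ k → (+ suc n) DU.∣ prefixSum (at (coord v)) k) (NP.+-comm a 1) (proj₂ (proj₂ (proj₁ isPl))))
  central′ : rangeSum (at (coord v)) (suc a) (b ∸ a) ≡ 0ℤ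
  central′ = subst₂ (λ p q → rangeSum (at (coord v)) p q ≡ 0ℤ) (NP.+-comm a 1) (∣+m-+n∣ b a a≤b) central
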